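{- Let $T$ be a twin set of a connected graph $G$ with $|T|\geq 3$. Then $F_{xt}(G)\leq F_{xt}(G-B)$ for every subset $B\subseteq T$ with $|B|\leq |T|-2$.
   Context: All graphs are finite, simple; throughout the paper graphs are assumed connected and symmetric (nontrivial automorphism group). Two distinct vertices $u,v$ are twins if $N(u)\setminus\{v\}=N(v)\setminus\{u\}$, where $N(x)$ is the set of neighbours of $x$. A twin set is a set of vertices any two of which are twins. A fixing set of $G$ is a set $F\subseteq V(G)$ such that the only automorphism fixing every vertex of $F$ is the identity. A fixatic partition of $G$ is a partition of $V(G)$ into classes each of which is a fixing set; $F_{xt}(G)$ is the maximum number of classes in a fixatic partition. $G-B$ is the graph obtained by deleting the vertices of $B$. -}

module Defs where

open import Data.Nat using (ℕ; _≤_)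
open import Data.Bool using (Bool; true; false; not; T)
open import Data.Fin using (Fin)
open import Data.Fin.Subset using (Subset; _∈_)
open import Data.Vec using (lookup)
open import Data.Product using (Σ; ∃; ∃-syntax; _×_; _,_; proj₁)
open import Relation.Binary.PropositionalEquality using (_≡_; _≢_)
open import Function.Bundles using (_↔_; Inverse)
open import Function.Definitions using (Surjective)

record Graph (V : Set) : Set where
  field
    adj    : V → V → Bool
    sym    : ∀ u v → adj u v ≡ adj v u
    irrefl : ∀ v → adj v v ≡ false
open Graph public

data Path {V : Set} (G : Graph V) : V → V → Set where
  here : ∀ {v} → Path G v v
  step : ∀ {u w v} → adj G u w ≡ true → Path G w v → Path G u v

Connected : ∀ {V} → Graph V → Set
Connected {V} G = ∀ (u v : V) → Path G u v

record Aut {V : Set} (G : Graph V) : Set where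
  field
    perm      : V ↔ V
    preserves : ∀ u v → adj G (Inverse.to perm u) (Inverse.to perm v) ≡ adj G u v
open Aut public

apply : ∀ {V} {G : Graph V} → Aut G → V → V
apply σ = Inverse.to (perm σ)

SymmetricGraph : ∀ {V} → Graph V → Set
SymmetricGraph {V} G = Σ (Aut G) λ σ → ∃[ v ] apply σ v ≢ v

Twins : ∀ {V} → Graph V → V → V → Set
Twins {V} G u v = u ≢ v × (∀ (w : V) → w ≢ u → w ≢ v → adj G u w ≡ adj G v w)

IsTwinSet : ∀ {n} → Graph (Fin n) → Subset n → Set
IsTwinSet {n} G S = ∀ (u v : Fin n) → u ∈ S → v ∈ S → u ≢ v → Twins G u v

FixingSet : ∀ {V} → (G : Graph V) → (V → Set) → Set
FixingSet {V} G F = ∀ (σ : Aut G) → (∀ v → F v → apply σ v ≡ v) → ∀ v → apply σ v ≡ v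

record FixaticPartition {V : Set} (G : Graph V) (k : ℕ) : Set where
  field
    cls      : V → Fin k
    nonempty : Surjective _≡_ _≡_ cls
    fixing   : ∀ (i : Fin k) → FixingSet G (λ v → cls v ≡ i)

IsFxt : ∀ {V} → Graph V → ℕ → Set
IsFxt G k = FixaticPartition G k × (∀ k' → FixaticPartition G k' → k' ≤ k)

Remaining : ∀ {n} → Subset n → Set
Remaining {n} B = Σ (Fin n) λ v → T (not (lookup B v))

_−_ : ∀ {n} → Graph (Fin n) → (B : Subset n) → Graph (Remaining B)
G − B = record
  { adj    = λ u v → adj G (proj₁ u) (proj₁ v)
  ; sym    = λ u v → sym G (proj₁ u) (proj₁ v)
  ; irrefl = λ v → irrefl G (proj₁ v) }

module Submission where

-- If u, v are twins, the transposition (u v) is an automorphism of G.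
-- A fixing set F must therefore contain u or v: otherwise (u v) fixes F
-- pointwise without being the identity.  Every class of a fixatic partition
-- is a fixing set, so every class meets every twin pair.  With three
-- pairwise twins a, b, c and two distinct classes i, j this is impossible:
-- if a ∉ i then b, c ∈ i, hence b, c ∉ j, and the pair {b, c} misses j.
-- So F_xt(G) ≤ 1.  On the other side, in any graph with at least one vertex
-- the single class V(G) is a fixing set, so F_xt(G - B) ≥ 1 as soon as
-- |B| < |V(G)|, which follows from |B| ≤ |T| - 2.

open import Defs
open import Data.Fin using (Fin)
open import Data.Nat using (_≤_; _∸_)
open import Data.Fin.Subset using (Subset; _⊆_; ∣_∣)

open import Data.Bool using (true; false; not; T)
open import Data.Empty using (⊥-elim) renaming (⊥ to Empty)
open import Data.Fin using (zero; suc)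
open import Data.Fin.Properties using (_≟_)
open import Data.Fin.Permutation using (transpose)
import Data.Fin.Permutation.Components as Components
open import Data.Fin.Subset using (inside; outside; _∈_; _∉_; _∪_; ⁅_⁆; ⊥; ⊤)
open import Data.Fin.Subset.Properties
  using (drop-there; ∣p∣≤n; ∣p∣≤∣x∷p∣; ∣⊥∣≡0; ∣⊤∣≡n; ∣⁅x⁆∣≡1; x∈⁅x⁆; x∈p∪q⁺)
open import Data.Nat as ℕ using (ℕ; _+_; _<_; z≤n; s≤s)
open import Data.Nat.Properties
  using (≤-refl; ≤-reflexive; ≤-trans; <-≤-trans; ≤-<-trans; +-suc; m≤n⇒m≤1+n; ∸-monoʳ-<)
open import Data.Product using (∃-syntax; _×_; _,_; proj₁; proj₂)
open import Data.Sum using (inj₁; inj₂)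
open import Data.Unit using (tt)
open import Data.Vec using ([]; _∷_; here; there; lookup)
open import Data.Vec.Properties using (lookup⇒[]=)
open import Relation.Nullary using (¬_; yes; no)
open import Relation.Nullary.Decidable using (dec-true; dec-false)
open import Relation.Binary.PropositionalEquality
  using (_≡_; _≢_; refl; trans; subst; subst₂; module ≡-Reasoning)
  renaming (sym to ≡-sym)

member-outside : ∀ {n} (p q : Subset n) → ∣ q ∣ < ∣ p ∣ → ∃[ x ] x ∈ p × x ∉ q
member-outside (inside ∷ p) (outside ∷ q) _ = zero , here , λ ()
member-outside (inside ∷ p) (inside ∷ q) (s≤s q<p) with member-outside p q q<p
... | x , x∈p , x∉q = suc x , there x∈p , λ sx∈q → x∉q (drop-there sx∈q)
member-outside (outside ∷ p) (s ∷ q) q<p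
  with member-outside p q (≤-<-trans (∣p∣≤∣x∷p∣ s q) q<p)
... | x , x∈p , x∉q = suc x , there x∈p , λ sx∈q → x∉q (drop-there sx∈q)

∣p∪q∣≤∣p∣+∣q∣ : ∀ {n} (p q : Subset n) → ∣ p ∪ q ∣ ≤ ∣ p ∣ + ∣ q ∣
∣p∪q∣≤∣p∣+∣q∣ []            []            = z≤n
∣p∪q∣≤∣p∣+∣q∣ (outside ∷ p) (outside ∷ q) = ∣p∪q∣≤∣p∣+∣q∣ p q
∣p∪q∣≤∣p∣+∣q∣ (inside ∷ p)  (outside ∷ q) = s≤s (∣p∪q∣≤∣p∣+∣q∣ p q)
∣p∪q∣≤∣p∣+∣q∣ (outside ∷ p) (inside ∷ q)  =
  ≤-trans (s≤s (∣p∪q∣≤∣p∣+∣q∣ p q)) (≤-reflexive (≡-sym (+-suc ∣ p ∣ ∣ q ∣)))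
∣p∪q∣≤∣p∣+∣q∣ (inside ∷ p)  (inside ∷ q)  =
  s≤s (≤-trans (m≤n⇒m≤1+n (∣p∪q∣≤∣p∣+∣q∣ p q)) (≤-reflexive (≡-sym (+-suc ∣ p ∣ ∣ q ∣))))

∣⁅x⁆∪⁅y⁆∣≤2 : ∀ {n} (x y : Fin n) → ∣ ⁅ x ⁆ ∪ ⁅ y ⁆ ∣ ≤ 2
∣⁅x⁆∪⁅y⁆∣≤2 x y = subst₂ (λ i j → ∣ ⁅ x ⁆ ∪ ⁅ y ⁆ ∣ ≤ i + j) (∣⁅x⁆∣≡1 x) (∣⁅x⁆∣≡1 y)
                    (∣p∪q∣≤∣p∣+∣q∣ ⁅ x ⁆ ⁅ y ⁆)

record DistinctTriple {n} (S : Subset n) : Set where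
  field
    a b c    : Fin n
    a∈S      : a ∈ S
    b∈S      : b ∈ S
    c∈S      : c ∈ S
    a≢b      : a ≢ b
    a≢c      : a ≢ c
    b≢c      : b ≢ c

distinctTriple : ∀ {n} (S : Subset n) → 3 ≤ ∣ S ∣ → DistinctTriple S
distinctTriple {n} S 3≤∣S∣
  with member-outside S ⊥ (subst (_< ∣ S ∣) (≡-sym (∣⊥∣≡0 n)) (≤-trans (s≤s z≤n) 3≤∣S∣))
... | a , a∈S , _
  with member-outside S ⁅ a ⁆ (subst (_< ∣ S ∣) (≡-sym (∣⁅x⁆∣≡1 a)) (≤-trans (s≤s (s≤s z≤n)) 3≤∣S∣))
... | b , b∈S , b∉⁅a⁆
  with member-outside S (⁅ a ⁆ ∪ ⁅ b ⁆) (≤-<-trans (∣⁅x⁆∪⁅y⁆∣≤2 a b) 3≤∣S∣)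
... | c , c∈S , c∉⁅a⁆∪⁅b⁆ = record
  { a = a ; b = b ; c = c ; a∈S = a∈S ; b∈S = b∈S ; c∈S = c∈S
  ; a≢b = λ { refl → b∉⁅a⁆ (x∈⁅x⁆ a) }
  ; a≢c = λ { refl → c∉⁅a⁆∪⁅b⁆ (x∈p∪q⁺ (inj₁ (x∈⁅x⁆ a))) }
  ; b≢c = λ { refl → c∉⁅a⁆∪⁅b⁆ (x∈p∪q⁺ (inj₂ (x∈⁅x⁆ b))) } }

module _ {n : ℕ} (u v : Fin n) where

  private
    τ : Fin n → Fin n
    τ = Components.transpose u v

  transpose-first : τ u ≡ v
  transpose-first rewrite dec-true (u ≟ u) refl = refl

  transpose-second : τ v ≡ u
  transpose-second with v ≟ u
  ... | yes v≡u = v≡u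
  ... | no _ rewrite dec-true (v ≟ v) refl = refl

  transpose-elsewhere : ∀ x → x ≢ u → x ≢ v → τ x ≡ x
  transpose-elsewhere x x≢u x≢v rewrite dec-false (x ≟ u) x≢u | dec-false (x ≟ v) x≢v = refl

  data Position (x : Fin n) : Set where
    atFirst   : x ≡ u → Position x
    atSecond  : x ≡ v → Position x
    elsewhere : x ≢ u → x ≢ v → Position x

  position : ∀ x → Position x
  position x with x ≟ u | x ≟ v
  ... | yes x≡u | _        = atFirst x≡u
  ... | no _    | yes x≡v  = atSecond x≡v
  ... | no x≢u  | no x≢v   = elsewhere x≢u x≢v

no-loops : ∀ {V : Set} (G : Graph V) (x y : V) → adj G x x ≡ adj G y y
no-loops G x y = trans (irrefl G x) (≡-sym (irrefl G y))

-- Swapping two twins u, v is an automorphism: adjacency to any third vertex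
-- is unchanged because u and v have the same neighbours there.
module _ {n : ℕ} (G : Graph (Fin n)) {u v : Fin n} (twins : Twins G u v) where

  private
    τ : Fin n → Fin n
    τ = Components.transpose u v

    same-neighbours : ∀ w → w ≢ u → w ≢ v → adj G u w ≡ adj G v w
    same-neighbours = proj₂ twins

  swap-invisible : ∀ x w → w ≢ u → w ≢ v → adj G (τ x) w ≡ adj G x w
  swap-invisible x w w≢u w≢v with position u v x
  ... | atFirst refl rewrite transpose-first u v = ≡-sym (same-neighbours w w≢u w≢v)
  ... | atSecond refl rewrite transpose-second u v = same-neighbours w w≢u w≢v
  ... | elsewhere x≢u x≢v rewrite transpose-elsewhere u v x x≢u x≢v = refl

  swap-preserves-at : ∀ x y → y ≢ u → y ≢ v → adj G (τ x) (τ y) ≡ adj G x y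
  swap-preserves-at x y y≢u y≢v rewrite transpose-elsewhere u v y y≢u y≢v =
    swap-invisible x y y≢u y≢v

  swap-preserves : ∀ x y → adj G (τ x) (τ y) ≡ adj G x y
  swap-preserves x y with position u v x | position u v y
  ... | _ | elsewhere y≢u y≢v = swap-preserves-at x y y≢u y≢v
  ... | elsewhere x≢u x≢v | _ =
    trans (Graph.sym G (τ x) (τ y))
          (trans (swap-preserves-at y x x≢u x≢v) (Graph.sym G y x))
  ... | atFirst refl  | atFirst refl  = no-loops G (τ u) u
  ... | atSecond refl | atSecond refl = no-loops G (τ v) v
  ... | atFirst refl  | atSecond refl
    rewrite transpose-first u v | transpose-second u v = Graph.sym G v u
  ... | atSecond refl | atFirst refl
    rewrite transpose-first u v | transpose-second u v = Graph.sym G u v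

  twinSwap : Aut G
  twinSwap = record { perm = transpose u v ; preserves = swap-preserves }

-- The swap of two twins fixes every vertex except the twins themselves, so
-- a fixing set missing both twins would be fixed by a nontrivial automorphism.
fixingSet-meets-twins : ∀ {n} (G : Graph (Fin n)) (F : Fin n → Set) → FixingSet G F →
  ∀ {u v} → Twins G u v → ¬ F u → ¬ F v → Empty
fixingSet-meets-twins G F fixing {u} {v} twins ¬Fu ¬Fv = u≢v (begin
    u                 ≡⟨ ≡-sym (fixing (twinSwap G twins) fixes-F u) ⟩
    apply σ u         ≡⟨ transpose-first u v ⟩
    v                 ∎)
  where
  open ≡-Reasoning
  σ : Aut G
  σ = twinSwap G twins
  u≢v : u ≢ v
  u≢v = proj₁ twins
  fixes-F : ∀ w → F w → apply σ w ≡ w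
  fixes-F w Fw = transpose-elsewhere u v w (λ { refl → ¬Fu Fw }) (λ { refl → ¬Fv Fw })

record TwinTriple {n} (G : Graph (Fin n)) : Set where
  field
    a b c : Fin n
    ab    : Twins G a b
    ac    : Twins G a c
    bc    : Twins G b c

twinTriple : ∀ {n} (G : Graph (Fin n)) (S : Subset n) → IsTwinSet G S → 3 ≤ ∣ S ∣ →
  TwinTriple G
twinTriple G S twinSet 3≤∣S∣ = record
  { a = a ; b = b ; c = c
  ; ab = twinSet a b a∈S b∈S a≢b
  ; ac = twinSet a c a∈S c∈S a≢c
  ; bc = twinSet b c b∈S c∈S b≢c }
  where open DistinctTriple (distinctTriple S 3≤∣S∣)

module _ {n k : ℕ} {G : Graph (Fin n)} (P : FixaticPartition G k) where

  open FixaticPartition P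

  twin-in-class : ∀ {u v} → Twins G u v → ∀ i → cls u ≢ i → cls v ≡ i
  twin-in-class {u} {v} twins i u∉i with cls v ≟ i
  ... | yes v∈i = v∈i
  ... | no v∉i =
    ⊥-elim (fixingSet-meets-twins G (λ w → cls w ≡ i) (fixing i) twins u∉i v∉i)

  -- If a misses class i, then b and c both lie in i, so {b, c} misses j.
  twinTriple-missing-class : (t : TwinTriple G) → ∀ {i j} → i ≢ j →
    cls (TwinTriple.a t) ≢ i → Empty
  twinTriple-missing-class t {i} {j} i≢j a∉i =
    i≢j (trans (≡-sym c∈i) (twin-in-class bc j λ b∈j → i≢j (trans (≡-sym b∈i) b∈j)))
    where
    open TwinTriple t
    b∈i : cls b ≡ i
    b∈i = twin-in-class ab i a∉i
    c∈i : cls c ≡ i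
    c∈i = twin-in-class ac i a∉i

-- Two distinct classes are impossible: a misses one of them.  Hence F_xt ≤ 1.
twinTriple-at-most-one-class : ∀ {n k} {G : Graph (Fin n)} → TwinTriple G →
  FixaticPartition G k → k ≤ 1
twinTriple-at-most-one-class {k = 0} t P = z≤n
twinTriple-at-most-one-class {k = 1} t P = ≤-refl
twinTriple-at-most-one-class {k = ℕ.suc (ℕ.suc m)} t P
  with FixaticPartition.cls P (TwinTriple.a t) ≟ zero
... | no a∉0  = ⊥-elim (twinTriple-missing-class P t {zero} {suc zero} (λ ()) a∉0)
... | yes a∈0 = ⊥-elim (twinTriple-missing-class P t {suc zero} {zero} (λ ())
                          λ a∈1 → 0≢1 (trans (≡-sym a∈0) a∈1))
  where
  0≢1 : zero ≢ suc zero
  0≢1 ()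

oneClassPartition : ∀ {V : Set} (G : Graph V) → V → FixaticPartition G 1
oneClassPartition G x = record
  { cls      = λ _ → zero
  ; nonempty = λ { zero → x , λ _ → refl }
  ; fixing   = λ { zero σ fixesAll v → fixesAll v refl } }

remaining : ∀ {n} {B : Subset n} {x : Fin n} → x ∉ B → Remaining B
remaining {B = B} {x} x∉B with lookup B x in eq
... | true  = ⊥-elim (x∉B (lookup⇒[]= x B eq))
... | false = x , subst (λ b → T (not b)) (≡-sym eq) tt

remaining-vertex : ∀ {n} (B : Subset n) → ∣ B ∣ < n → Remaining B
remaining-vertex {n} B ∣B∣<n
  with member-outside ⊤ B (subst (∣ B ∣ <_) (≡-sym (∣⊤∣≡n n)) ∣B∣<n)
... | _ , _ , x∉B = remaining x∉B

-- F_xt(G) ≤ 1 because of the three twins, and F_xt(G - B) ≥ 1 because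
-- |B| ≤ |T| - 2 < |T| ≤ n leaves a vertex.
mainTheorem4 : ∀ {n} (G : Graph (Fin n)) → Connected G → SymmetricGraph G →
    (S : Subset n) → IsTwinSet G S → 3 ≤ ∣ S ∣ →
    ∀ (B : Subset n) → B ⊆ S → ∣ B ∣ ≤ ∣ S ∣ ∸ 2 →
    ∀ k k' → IsFxt G k → IsFxt (G − B) k' → k ≤ k'
mainTheorem4 {n} G _ _ S twinSet 3≤∣S∣ B _ ∣B∣≤∣S∣∸2 k k' (P , _) (_ , maximal) =
  ≤-trans k≤1 1≤k'
  where
  k≤1 : k ≤ 1
  k≤1 = twinTriple-at-most-one-class (twinTriple G S twinSet 3≤∣S∣) P
  ∣B∣<n : ∣ B ∣ < n
  ∣B∣<n = ≤-<-trans ∣B∣≤∣S∣∸2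
            (<-≤-trans (∸-monoʳ-< (s≤s z≤n) (≤-trans (s≤s (s≤s z≤n)) 3≤∣S∣)) (∣p∣≤n S))
  1≤k' : 1 ≤ k'
  1≤k' = maximal 1 (oneClassPartition (G − B) (remaining-vertex B ∣B∣<n))
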